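{- Let $U=(U_{ij})_{i,j\in I}$ be a nonsingular $\mathcal U$-matrix with distinguished leaf $n$. If there exists $i\ne n$ with $U_{ii}\le U_{nn}$, then $n$ is not an exiting root of $P$, i.e. $(U^{ -1}\mathbf 1)_n\le 0$.
   Context: Trees. $(T,\mathcal J)$ is a finite tree with distinguished root $r$; $\mathrm{geod}(s,t)$ is the shortest path between $s,t$; $s\preceq t$ if $s$ lies on $\mathrm{geod}(t,r)$; $s\wedge t$ is the $\preceq$-largest vertex on both $\mathrm{geod}(s,r)$ and $\mathrm{geod}(t,r)$. Leaves are vertices with no successors (neighbours $s\ne t$ with $t\preceq s$), their set is $I$. Dyadic: every non-leaf $t$ has exactly two successors $t^-,t^+$; each vertex is identified with the set of leaves below it. $\mathcal U$-matrices. A real matrix $U=(U_{ij})_{i,j\in I}$ is a $\mathcal U$-matrix if there exist a dyadic tree with root $r$ and leaf set $I$, a distinguished leaf $n$, and nonnegative vectors $(\alpha_t),(\beta_t)$ on $T$ with: (i) $\alpha_i=\beta_i$ for leaves, and $\alpha_t=\alpha_{t\wedge n}$ for non-leaf $t$ with $r^+\preceq t$; (ii) $\alpha_t\le\beta_t$; (iii) $t\preceq s\Rightarrow\alpha_t\le\alpha_s,\beta_t\le\beta_s$; (iv) for non-leaf $t$ on $\mathrm{geod}(r,n)$, $t^+$ is on $\mathrm{geod}(r,n)$, and $\alpha_t=\beta_t$ on $\mathrm{geod}(r,n)$; (v) $U_{ii}=\alpha_i$, and for $i\ne j$, $t=i\wedge j$: $U_{ij}=\alpha_t$ if $i\in t^-,j\in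 t^+$; $U_{ij}=\beta_s$ if $i\in t^+,j\in t^-$, with $s$ the $\preceq$-larger of $i\wedge j$, $i\wedge n$. Leaves are labelled $\{1,\dots,n\}$ with $i<j$ iff $i\in(i\wedge j)^-,j\in(i\wedge j)^+$; the distinguished leaf is $n$. Exiting roots of $P$: for $P=E-\eta^{ -1}U^{ -1}$ with $\eta\ge\max_i(U^{ -1})_{ii}$, $i$ is an exiting root iff $(P\mathbf 1)_i<1$, equivalently $(U^{ -1}\mathbf 1)_i>0$. -}

module Defs where

open import Level using (0ℓ)
open import Data.Nat as ℕ using (ℕ; zero; suc)
open import Data.Fin using (Fin; zero; suc; splitAt; cast; fromℕ)
open import Data.Sum using (_⊎_; inj₁; inj₂)
open import Data.Product using (Σ; _×_; _,_)
open import Data.Unit using (⊤)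
open import Data.Bool using (Bool; true; false)
open import Relation.Nullary using (¬_)
open import Relation.Binary.PropositionalEquality using (_≡_; sym)
open import Algebra.Structures using (IsCommutativeRing)
open import Relation.Binary.Structures using (IsTotalOrder)

-- Ordered fields (the statement is about real matrices; we state it for
-- an arbitrary ordered field, which includes ℝ).

record OrderedField : Set₁ where
  infixl 6 _+_
  infixl 7 _*_
  infix  4 _≤_
  field
    Carrier : Set
    _+_ _*_ : Carrier → Carrier → Carrier
    -_      : Carrier → Carrier
    0# 1#   : Carrier
    _≤_     : Carrier → Carrier → Set
    isCommutativeRing : IsCommutativeRing _≡_ _+_ _*_ -_ 0# 1#
    isTotalOrder      : IsTotalOrder _≡_ _≤_
    0≢1     : ¬ (0# ≡ 1#)
    inverse : ∀ a → ¬ (a ≡ 0#) → Σ Carrier (λ b → a * b ≡ 1#)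
    +-monoˡ : ∀ {a b} c → a ≤ b → a + c ≤ b + c
    *-nonneg : ∀ {a b} → 0# ≤ a → 0# ≤ b → 0# ≤ a * b

module _ (F : OrderedField) where
  open OrderedField F

  Σ[_] : ∀ {m} → (Fin m → Carrier) → Carrier
  Σ[_] {zero}  f = 0#
  Σ[_] {suc m} f = f zero + Σ[_] (λ i → f (suc i))

  Matrix : ℕ → Set
  Matrix m = Fin m → Fin m → Carrier

  _·_ : ∀ {m} → Matrix m → Matrix m → Matrix m
  (A · B) i j = Σ[ (λ k → A i k * B k j) ]

  idM : ∀ {m} → Matrix m
  idM {suc m} zero    zero    = 1#
  idM {suc m} zero    (suc j) = 0#
  idM {suc m} (suc i) zero    = 0#
  idM {suc m} (suc i) (suc j) = idM i j

  IsInverse : ∀ {m} → Matrix m → Matrix m → Set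
  IsInverse U V = (∀ i j → (U · V) i j ≡ idM i j) × (∀ i j → (V · U) i j ≡ idM i j)

  rowSum : ∀ {m} → Matrix m → Fin m → Carrier
  rowSum V i = Σ[ (λ j → V i j) ]

  -- A leaf carries one value (α_i = β_i); an inner node t carries α_t, β_t,
  -- its left subtree is t⁻ and its right subtree is t⁺.
  -- Leaves are numbered 0 … size-1 from left to right (so i < j iff
  -- i ∈ (i∧j)⁻ and j ∈ (i∧j)⁺); the distinguished leaf n is the last one.

  data LTree : Set where
    leaf : Carrier → LTree
    node : (α β : Carrier) → LTree → LTree → LTree

  size : LTree → ℕ
  size (leaf _)       = 1
  size (node _ _ l r) = size l ℕ.+ size r

  αroot βroot : LTree → Carrier
  αroot (leaf a)       = a
  αroot (node a _ _ _) = a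
  βroot (leaf a)       = a
  βroot (node _ b _ _) = b

  Nonneg : LTree → Set
  Nonneg (leaf a)       = 0# ≤ a
  Nonneg (node a b l r) = 0# ≤ a × 0# ≤ b × Nonneg l × Nonneg r

  AlphaLeBeta : LTree → Set
  AlphaLeBeta (leaf a)       = ⊤
  AlphaLeBeta (node a b l r) = a ≤ b × AlphaLeBeta l × AlphaLeBeta r

  -- (iii) monotonicity along the tree order (parent–child suffices)
  Monotone : LTree → Set
  Monotone (leaf a)       = ⊤
  Monotone (node a b l r) =
    a ≤ αroot l × a ≤ αroot r × b ≤ βroot l × b ≤ βroot r × Monotone l × Monotone r

  -- (iv) α_t = β_t on geod(r,n) (the right spine; t⁺ on the spine is forced
  -- by n being the last leaf)
  SpineEq : LTree → Set
  SpineEq (leaf a)       = ⊤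
  SpineEq (node a b l r) = a ≡ b × SpineEq r

  -- (i) for non-leaf t with r⁺ ⪯ t : α_t = α_{t∧n}.
  -- OffSpine v T : every inner node of T has α = v (T hangs to the left of
  -- a spine node whose α is v, so that node is t∧n).
  OffSpine : Carrier → LTree → Set
  OffSpine v (leaf a)       = ⊤
  OffSpine v (node a b l r) = a ≡ v × OffSpine v l × OffSpine v r

  OnSpine : LTree → Set
  OnSpine (leaf a)       = ⊤
  OnSpine (node a b l r) = OffSpine a l × OnSpine r

  CondI : LTree → Set
  CondI (leaf a)       = ⊤
  CondI (node a b l r) = OnSpine r

  ValidU : LTree → Set
  ValidU T = Nonneg T × CondI T × AlphaLeBeta T × Monotone T × SpineEq T

  -- β_{i∧n} for a leaf i of a subtree T rooted on the spine
  βmeetN : (T : LTree) → Fin (size T) → Carrier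
  βmeetN (leaf a)       i = a
  βmeetN (node a b l r) i with splitAt (size l) i
  ... | inj₁ _  = b
  ... | inj₂ i' = βmeetN r i'

  -- (v) the matrix entries; the Bool records whether the root of the
  -- current subtree lies on geod(r,n).
  UMat' : Bool → (T : LTree) → Fin (size T) → Fin (size T) → Carrier
  UMat' s (leaf a) i j = a
  UMat' s (node a b l r) i j with splitAt (size l) i | splitAt (size l) j
  ... | inj₁ i' | inj₁ j' = UMat' false l i' j'
  ... | inj₂ i' | inj₂ j' = UMat' s r i' j'
  ... | inj₁ i' | inj₂ j' = a
  ... | inj₂ i' | inj₁ j' with s
  ...   | true  = βmeetN r i'
  ...   | false = b

  UMat : (T : LTree) → Matrix (size T)
  UMat = UMat' true

  -- U (indexed by Fin (suc k), last index = distinguished leaf n) is a U-matrix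
  IsUMatrix : ∀ {k} → Matrix (suc k) → Set
  IsUMatrix {k} U = Σ LTree λ T → Σ (size T ≡ suc k) λ eq →
    ValidU T × (∀ i j → U i j ≡ UMat T (cast (sym eq) i) (cast (sym eq) j))

-- Let y be the last row of U⁻¹, so yU = eₙ, and walk down the spine geod(r,n). At a spine
-- node (a = b) with children l and r, the columns of r see the constant a in the rows of l,
-- and the columns of l see β_{i∧n} in the rows of r, which are the entries of the last
-- column; hence −y_l solves (−y_l)(U_l − a) = 𝟙. For a subtree off the spine and d ≤ α,
-- induction over the tree shows that every solution of y(M − d) = γ𝟙 has either ∑y ≥ 0 and
-- (β − d)∑y ≤ γ ≤ (M_ii − d)∑y, or γ ≤ (β − d)∑y ≤ 0. For γ = 1 only the first case can
-- occur, giving ∑y_l ≤ 0 and (U_ii − a)(−∑y_l) ≥ 1 on l. Carried down the spine this yields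
-- U_nn ∑y ≤ 1, and U_nn ∑y ≤ 0 as soon as some i ≠ n has U_ii ≤ U_nn; finally U_nn > 0,
-- since otherwise the last column of U would vanish.
module Submission where

open import Defs
open import Level using (0ℓ)
open import Algebra.Bundles using (CommutativeRing)
open import Data.Bool.Base using (Bool; true; false)
open import Data.Empty using (⊥-elim)
open import Data.Fin.Base using (Fin; zero; suc; _↑ˡ_; _↑ʳ_; cast; splitAt; toℕ; fromℕ)
import Data.Fin.Properties as Finₚ
open import Data.Integer.Base as ℤ using (ℤ; -[1+_]; _⊖_; _◃_)
import Data.Integer.Properties as ℤₚ
import Data.Maybe.Base as Maybe
open import Data.Nat.Base as ℕ using (ℕ; zero; suc)
import Data.Nat.Properties as ℕₚ
open import Data.Product.Base using (Σ; _,_; _×_; proj₁; proj₂)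
import Data.Sign.Base as Sign
open import Data.Sum.Base using (_⊎_; inj₁; inj₂)
open import Function.Base using (_∘_)
open import Relation.Binary.Bundles using (Poset)
open import Relation.Binary.PropositionalEquality
  using (_≡_; refl; sym; trans; cong; cong₂; subst; subst₂; module ≡-Reasoning)
import Relation.Binary.Reasoning.PartialOrder
open import Relation.Binary.Structures using (IsTotalOrder)
open import Relation.Nullary.Decidable.Core using (dec⇒maybe)
open import Relation.Nullary.Negation using (¬_)

-- The ring solver only cancels monomials whose coefficients it can compare, and an ordered
-- field has no decidable equality; so the coefficients are integers, acting through ℤ → R.
module IntegerCoefficients {c ℓ} (R : CommutativeRing c ℓ) where
  open CommutativeRing R renaming (refl to ≈-refl; sym to ≈-sym; trans to ≈-trans)
  open import Algebra.Properties.Ring ring using (-‿distribˡ-*; -‿distribʳ-*)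
  open import Algebra.Properties.AbelianGroup +-abelianGroup using (⁻¹-∙-comm)
  open import Algebra.Properties.Group +-group using (ε⁻¹≈ε; ⁻¹-involutive)
  open import Algebra.Properties.Semiring.Mult semiring using (×-homo-+; ×1-homo-*)
    renaming (_×_ to _×ᵤ_)
  open import Algebra.Solver.Ring.AlmostCommutativeRing
    using (fromCommutativeRing; _-Raw-AlmostCommutative⟶_)
  open import Relation.Binary.Reasoning.Setoid setoid

  fromℤ : ℤ → Carrier
  fromℤ (ℤ.+ n)    = n ×ᵤ 1#
  fromℤ -[1+ n ]   = - (suc n ×ᵤ 1#)

  -‿homo : ∀ i → fromℤ (ℤ.- i) ≈ - fromℤ i
  -‿homo (ℤ.+ zero)  = ≈-sym ε⁻¹≈ε
  -‿homo (ℤ.+ suc n) = ≈-refl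
  -‿homo -[1+ n ]    = ≈-sym (⁻¹-involutive _)

  ⊖-homo : ∀ m n → fromℤ (m ⊖ n) ≈ m ×ᵤ 1# - n ×ᵤ 1#
  ⊖-homo zero    zero    = ≈-sym (-‿inverseʳ 0#)
  ⊖-homo zero    (suc n) = ≈-sym (+-identityˡ _)
  ⊖-homo (suc m) zero    = ≈-sym (≈-trans (+-congˡ ε⁻¹≈ε) (+-identityʳ _))
  ⊖-homo (suc m) (suc n) = begin
    fromℤ (suc m ⊖ suc n)    ≡⟨ cong fromℤ (ℤₚ.[1+m]⊖[1+n]≡m⊖n m n) ⟩
    fromℤ (m ⊖ n)            ≈⟨ ⊖-homo m n ⟩
    x + - y                  ≈⟨ +-congˡ (+-identityˡ _) ⟨
    x + (0# + - y)           ≈⟨ +-congˡ (+-congʳ (-‿inverseʳ 1#)) ⟨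
    x + ((1# + - 1#) + - y)  ≈⟨ +-congˡ (+-assoc _ _ _) ⟩
    x + (1# + (- 1# + - y))  ≈⟨ +-assoc _ _ _ ⟨
    (x + 1#) + (- 1# + - y)  ≈⟨ +-cong (+-comm _ _) (⁻¹-∙-comm _ _) ⟩
    (1# + x) + - (1# + y)    ∎
    where x = m ×ᵤ 1#; y = n ×ᵤ 1#

  +-homo : ∀ i j → fromℤ (i ℤ.+ j) ≈ fromℤ i + fromℤ j
  +-homo (ℤ.+ m)  (ℤ.+ n)  = ×-homo-+ 1# m n
  +-homo (ℤ.+ m)  -[1+ n ] = ⊖-homo m (suc n)
  +-homo -[1+ m ] (ℤ.+ n)  = ≈-trans (⊖-homo n (suc m)) (+-comm _ _)
  +-homo -[1+ m ] -[1+ n ] = begin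
    - (suc (suc (m ℕ.+ n)) ×ᵤ 1#)      ≡⟨ cong (λ k → - (suc k ×ᵤ 1#)) (ℕₚ.+-suc m n) ⟨
    - ((suc m ℕ.+ suc n) ×ᵤ 1#)        ≈⟨ -‿cong (×-homo-+ 1# (suc m) (suc n)) ⟩
    - (suc m ×ᵤ 1# + suc n ×ᵤ 1#)      ≈⟨ ⁻¹-∙-comm _ _ ⟨
    - (suc m ×ᵤ 1#) + - (suc n ×ᵤ 1#)  ∎

  *-homo : ∀ i j → fromℤ (i ℤ.* j) ≈ fromℤ i * fromℤ j
  *-homo (ℤ.+ m)  (ℤ.+ n)  = ≈-trans (reflexive (cong fromℤ (ℤₚ.+◃n≡+n (m ℕ.* n)))) (×1-homo-* m n)
  *-homo (ℤ.+ m)  -[1+ n ] = begin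
    fromℤ (Sign.- ◃ (m ℕ.* suc n))      ≡⟨ cong fromℤ (ℤₚ.-◃n≡-n (m ℕ.* suc n)) ⟩
    fromℤ (ℤ.- (ℤ.+ (m ℕ.* suc n)))     ≈⟨ -‿homo (ℤ.+ (m ℕ.* suc n)) ⟩
    - ((m ℕ.* suc n) ×ᵤ 1#)             ≈⟨ -‿cong (×1-homo-* m (suc n)) ⟩
    - (m ×ᵤ 1# * suc n ×ᵤ 1#)           ≈⟨ -‿distribʳ-* _ _ ⟩
    m ×ᵤ 1# * - (suc n ×ᵤ 1#)           ∎
  *-homo -[1+ m ] (ℤ.+ n)  = begin
    fromℤ (Sign.- ◃ (suc m ℕ.* n))      ≡⟨ cong fromℤ (ℤₚ.-◃n≡-n (suc m ℕ.* n)) ⟩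
    fromℤ (ℤ.- (ℤ.+ (suc m ℕ.* n)))     ≈⟨ -‿homo (ℤ.+ (suc m ℕ.* n)) ⟩
    - ((suc m ℕ.* n) ×ᵤ 1#)             ≈⟨ -‿cong (×1-homo-* (suc m) n) ⟩
    - (suc m ×ᵤ 1# * n ×ᵤ 1#)           ≈⟨ -‿distribˡ-* _ _ ⟩
    - (suc m ×ᵤ 1#) * n ×ᵤ 1#           ∎
  *-homo -[1+ m ] -[1+ n ] = begin
    fromℤ (Sign.+ ◃ (suc m ℕ.* suc n))  ≡⟨ cong fromℤ (ℤₚ.+◃n≡+n (suc m ℕ.* suc n)) ⟩
    (suc m ℕ.* suc n) ×ᵤ 1#             ≈⟨ ×1-homo-* (suc m) (suc n) ⟩
    x * y                               ≈⟨ ⁻¹-involutive _ ⟨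
    - - (x * y)                         ≈⟨ -‿cong (-‿distribʳ-* x y) ⟩
    - (x * - y)                         ≈⟨ -‿distribˡ-* x (- y) ⟩
    - x * - y                           ∎
    where x = suc m ×ᵤ 1#; y = suc n ×ᵤ 1#

  ℤ⟶R : ℤ.+-*-rawRing -Raw-AlmostCommutative⟶ fromCommutativeRing R
  ℤ⟶R = record
    { ⟦_⟧    = fromℤ
    ; +-homo = +-homo
    ; *-homo = *-homo
    ; -‿homo = -‿homo
    ; 0-homo = ≈-refl
    ; 1-homo = +-identityʳ 1#
    }

  open import Algebra.Solver.Ring ℤ.+-*-rawRing (fromCommutativeRing R) ℤ⟶R
    (λ i j → Maybe.map (reflexive ∘ cong fromℤ) (dec⇒maybe (i ℤₚ.≟ j))) public

↑-cases : ∀ {m n} (P : Fin (m ℕ.+ n) → Set) →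
          (∀ p → P (p ↑ˡ n)) → (∀ q → P (m ↑ʳ q)) → ∀ i → P i
↑-cases {m} P left right i with splitAt m i in eq
... | inj₁ p = subst P (Finₚ.splitAt⁻¹-↑ˡ eq) (left p)
... | inj₂ q = subst P (Finₚ.splitAt⁻¹-↑ʳ eq) (right q)

module _ (F : OrderedField) where
  open OrderedField F

  commutativeRing : CommutativeRing 0ℓ 0ℓ
  commutativeRing = record { isCommutativeRing = isCommutativeRing }

  open CommutativeRing commutativeRing
    using ( +-assoc; +-comm; +-identityˡ; +-identityʳ; -‿inverseʳ
          ; *-comm; *-identityˡ; *-identityʳ; zeroˡ; zeroʳ; distribˡ; distribʳ)
  open IntegerCoefficients commutativeRing using (solve; _:=_; _:+_; _:*_; _:-_; :-_; con)
  open IsTotalOrder isTotalOrder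
    renaming (refl to ≤-refl; reflexive to ≤-reflexive; trans to ≤-trans; antisym to ≤-antisym)
    using (total)

  ≤-poset : Poset 0ℓ 0ℓ 0ℓ
  ≤-poset = record { isPartialOrder = IsTotalOrder.isPartialOrder isTotalOrder }

  module ≤-Reasoning = Relation.Binary.Reasoning.PartialOrder ≤-poset

  infixl 6 _−_
  _−_ : Carrier → Carrier → Carrier
  x − y = x + - y

  x−y+y≡x : ∀ x y → x − y + y ≡ x
  x−y+y≡x = solve 2 (λ x y → x :- y :+ y := x) refl

  x+[y−x]≡y : ∀ x y → x + (y − x) ≡ y
  x+[y−x]≡y = solve 2 (λ x y → x :+ (y :- x) := y) refl

  -0#≡0# : - 0# ≡ 0#
  -0#≡0# = solve 0 (:- con (ℤ.+ 0) := con (ℤ.+ 0)) refl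

  x+z≡y⇒x≡y−z : ∀ {x y z} → x + z ≡ y → x ≡ y − z
  x+z≡y⇒x≡y−z {x} {z = z} refl = sym (solve 2 (λ x z → x :+ z :- z := x) refl x z)

  +-monoʳ-≤ : ∀ c {a b} → a ≤ b → c + a ≤ c + b
  +-monoʳ-≤ c {a} {b} a≤b = subst₂ _≤_ (+-comm a c) (+-comm b c) (+-monoˡ c a≤b)

  +-mono-≤ : ∀ {a b c d} → a ≤ b → c ≤ d → a + c ≤ b + d
  +-mono-≤ {b = b} a≤b c≤d = ≤-trans (+-monoˡ _ a≤b) (+-monoʳ-≤ b c≤d)

  +-nonneg : ∀ {a b} → 0# ≤ a → 0# ≤ b → 0# ≤ a + b
  +-nonneg 0≤a 0≤b = subst (_≤ _) (+-identityʳ 0#) (+-mono-≤ 0≤a 0≤b)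

  x≤y⇒0≤y−x : ∀ {x y} → x ≤ y → 0# ≤ y − x
  x≤y⇒0≤y−x {x} x≤y = subst (_≤ _) (-‿inverseʳ x) (+-monoˡ (- x) x≤y)

  ≤-from-difference : ∀ {x y e} → y − x ≡ e → 0# ≤ e → x ≤ y
  ≤-from-difference {x} {y} {e} y−x≡e 0≤e = subst₂ _≤_ (+-identityˡ x) x+e≡y (+-monoˡ x 0≤e)
    where
    x+e≡y : e + x ≡ y
    x+e≡y = trans (cong (_+ x) (sym y−x≡e)) (x−y+y≡x y x)

  x≤0⇒0≤-x : ∀ {x} → x ≤ 0# → 0# ≤ - x
  x≤0⇒0≤-x {x} x≤0 = subst (0# ≤_) (+-identityˡ (- x)) (x≤y⇒0≤y−x x≤0)

  0≤-x⇒x≤0 : ∀ {x} → 0# ≤ - x → x ≤ 0#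
  0≤-x⇒x≤0 {x} = ≤-from-difference (+-identityˡ (- x))

  0≤1 : 0# ≤ 1#
  0≤1 with total 0# 1#
  ... | inj₁ 0≤1 = 0≤1
  ... | inj₂ 1≤0 = subst (0# ≤_) (trans (solve 1 (λ x → :- x :* :- x := x :* x) refl 1#) (*-identityʳ 1#))
                     (*-nonneg (x≤0⇒0≤-x 1≤0) (x≤0⇒0≤-x 1≤0))

  1≰0 : ¬ (1# ≤ 0#)
  1≰0 1≤0 = 0≢1 (≤-antisym 0≤1 1≤0)

  *-nonpos : ∀ {x y} → 0# ≤ x → y ≤ 0# → x * y ≤ 0#
  *-nonpos {x} {y} 0≤x y≤0 = 0≤-x⇒x≤0
    (subst (0# ≤_) (solve 2 (λ x y → x :* :- y := :- (x :* y)) refl x y) (*-nonneg 0≤x (x≤0⇒0≤-x y≤0)))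

  *-monoʳ-≤-nonneg : ∀ {x y z} → 0# ≤ z → x ≤ y → x * z ≤ y * z
  *-monoʳ-≤-nonneg {x} {y} {z} 0≤z x≤y = ≤-from-difference
    (solve 3 (λ x y z → y :* z :- x :* z := (y :- x) :* z) refl x y z) (*-nonneg (x≤y⇒0≤y−x x≤y) 0≤z)

  *-antimonoʳ-≤-nonpos : ∀ {x y z} → z ≤ 0# → x ≤ y → y * z ≤ x * z
  *-antimonoʳ-≤-nonpos {x} {y} {z} z≤0 x≤y = ≤-from-difference
    (solve 3 (λ x y z → x :* z :- y :* z := (y :- x) :* :- z) refl x y z)
    (*-nonneg (x≤y⇒0≤y−x x≤y) (x≤0⇒0≤-x z≤0))

  scale-down-nonpos : ∀ {p q y} → 0# ≤ p → p ≤ q → q * y ≤ 0# → q * y ≤ p * y × p * y ≤ 0#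
  scale-down-nonpos {p} {q} {y} 0≤p p≤q qy≤0 with total y 0#
  ... | inj₁ y≤0 = *-antimonoʳ-≤-nonpos y≤0 p≤q , *-nonpos 0≤p y≤0
  ... | inj₂ 0≤y = ≤-trans qy≤0 (*-nonneg 0≤p 0≤y) , ≤-trans (*-monoʳ-≤-nonneg 0≤y p≤q) qy≤0

  *-cancelˡ-nonpos : ∀ {c x} → 0# ≤ c → ¬ (c ≡ 0#) → c * x ≤ 0# → x ≤ 0#
  *-cancelˡ-nonpos {c} {x} 0≤c c≢0 cx≤0 with total x 0# | inverse c c≢0
  ... | inj₁ x≤0 | _             = x≤0
  ... | inj₂ 0≤x | c⁻¹ , cc⁻¹≡1 = ≤-reflexive x≡0
    where
    open ≡-Reasoning

    cx≡0 : c * x ≡ 0#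
    cx≡0 = ≤-antisym cx≤0 (*-nonneg 0≤c 0≤x)

    x≡0 : x ≡ 0#
    x≡0 = begin
      x                  ≡⟨ *-identityˡ x ⟨
      1# * x             ≡⟨ cong (_* x) cc⁻¹≡1 ⟨
      c * c⁻¹ * x        ≡⟨ solve 3 (λ c d x → c :* d :* x := d :* (c :* x)) refl c c⁻¹ x ⟩
      c⁻¹ * (c * x)      ≡⟨ cong (c⁻¹ *_) cx≡0 ⟩
      c⁻¹ * 0#           ≡⟨ zeroʳ c⁻¹ ⟩
      0#                 ∎

  ∑ : ∀ {m} → (Fin m → Carrier) → Carrier
  ∑ = Σ[_] F

  ∑-cong : ∀ {m} {f g : Fin m → Carrier} → (∀ i → f i ≡ g i) → ∑ f ≡ ∑ g
  ∑-cong {zero}  f≗g = refl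
  ∑-cong {suc m} f≗g = cong₂ _+_ (f≗g zero) (∑-cong (f≗g ∘ suc))

  ∑-split : ∀ m {n} (f : Fin (m ℕ.+ n) → Carrier) → ∑ f ≡ ∑ (f ∘ (_↑ˡ n)) + ∑ (f ∘ (m ↑ʳ_))
  ∑-split zero    f = sym (+-identityˡ _)
  ∑-split (suc m) f = trans (cong (f zero +_) (∑-split m (f ∘ suc))) (sym (+-assoc _ _ _))

  ∑-*ʳ : ∀ {m} (f : Fin m → Carrier) c → ∑ (λ i → f i * c) ≡ ∑ f * c
  ∑-*ʳ {zero}  f c = sym (zeroˡ c)
  ∑-*ʳ {suc m} f c = trans (cong (f zero * c +_) (∑-*ʳ (f ∘ suc) c)) (sym (distribʳ c _ _))

  ∑-*-const : ∀ {m} (y x : Fin m → Carrier) {c} → (∀ q → x q ≡ c) → ∑ (λ q → y q * x q) ≡ c * ∑ y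
  ∑-*-const y x {c} x≗c = trans (∑-cong (λ q → cong (y q *_) (x≗c q))) (trans (∑-*ʳ y c) (*-comm _ c))

  ∑-neg : ∀ {m} (f : Fin m → Carrier) → ∑ (λ i → - f i) ≡ - ∑ f
  ∑-neg {zero}  f = sym -0#≡0#
  ∑-neg {suc m} f = trans (cong (- f zero +_) (∑-neg (f ∘ suc)))
                          (solve 2 (λ x y → :- x :+ :- y := :- (x :+ y)) refl _ _)

  ∑-cast : ∀ {m n} (e : m ≡ n) (f : Fin n → Carrier) → ∑ (f ∘ cast e) ≡ ∑ f
  ∑-cast refl f = ∑-cong (cong f ∘ Finₚ.cast-is-id refl)

  infixl 7 _ᵀ·_
  _ᵀ·_ : ∀ {m} → (Fin m → Carrier) → Matrix F m → Fin m → Carrier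
  (y ᵀ· A) j = ∑ (λ p → y p * A p j)

  infixl 6 _−ᴹ_
  _−ᴹ_ : ∀ {m} → Matrix F m → Carrier → Matrix F m
  (A −ᴹ d) p q = A p q − d

  ∑-*-shift : ∀ {m} (y a : Fin m → Carrier) d →
              ∑ (λ p → y p * (a p − d)) ≡ ∑ (λ p → y p * a p) − ∑ y * d
  ∑-*-shift {zero}  y a d = solve 1 (λ d → con (ℤ.+ 0) := con (ℤ.+ 0) :- con (ℤ.+ 0) :* d) refl d
  ∑-*-shift {suc m} y a d = trans (cong (y zero * (a zero − d) +_) (∑-*-shift (y ∘ suc) (a ∘ suc) d))
    (solve 5 (λ y₀ a₀ d s t → y₀ :* (a₀ :- d) :+ (s :- t :* d) := (y₀ :* a₀ :+ s) :- (y₀ :+ t) :* d) refl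
       (y zero) (a zero) d _ _)

  ᵀ·-neg : ∀ {m} (y : Fin m → Carrier) (A : Matrix F m) j → ((λ p → - y p) ᵀ· A) j ≡ - (y ᵀ· A) j
  ᵀ·-neg y A j = trans (∑-cong (λ p → solve 2 (λ y a → :- y :* a := :- (y :* a)) refl (y p) (A p j)))
                       (∑-neg (λ p → y p * A p j))

  idM-diag : ∀ {m} (i : Fin m) → idM F i i ≡ 1#
  idM-diag zero    = refl
  idM-diag (suc i) = idM-diag i

  idM-↑ʳ : ∀ m {n} (i j : Fin n) → idM F (m ↑ʳ i) (m ↑ʳ j) ≡ idM F i j
  idM-↑ʳ zero    i j = refl
  idM-↑ʳ (suc m) i j = idM-↑ʳ m i j

  idM-↑ʳ-↑ˡ : ∀ {m n} (i : Fin n) (j : Fin m) → idM F (m ↑ʳ i) (j ↑ˡ n) ≡ 0#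
  idM-↑ʳ-↑ˡ i zero    = refl
  idM-↑ʳ-↑ˡ i (suc j) = idM-↑ʳ-↑ˡ i j

  idM-cast : ∀ {m n} .(e : m ≡ n) (i j : Fin m) → idM F (cast e i) (cast e j) ≡ idM F i j
  idM-cast {suc m} {suc n} e zero    zero    = refl
  idM-cast {suc m} {suc n} e zero    (suc j) = refl
  idM-cast {suc m} {suc n} e (suc i) zero    = refl
  idM-cast {suc m} {suc n} e (suc i) (suc j) = idM-cast (cong ℕ.pred e) i j

  -- Blocks of U-matrices

  -- Entry U_ij for i in the right and j in the left subtree of a node (b, r): by (v) it is
  -- β_{i∧n} when the node lies on geod(r,n), and b otherwise.
  lowerLeft : Bool → Carrier → (r : LTree F) → Fin (size F r) → Carrier
  lowerLeft true  _ r q = βmeetN F r q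
  lowerLeft false b _ _ = b

  module _ {s : Bool} (a b : Carrier) (l r : LTree F) where
    private
      T = node a b l r
      nl = size F l
      nr = size F r

    UMat'-↑ˡ-↑ˡ : ∀ p q → UMat' F s T (p ↑ˡ nr) (q ↑ˡ nr) ≡ UMat' F false l p q
    UMat'-↑ˡ-↑ˡ p q rewrite Finₚ.splitAt-↑ˡ nl p nr | Finₚ.splitAt-↑ˡ nl q nr = refl

    UMat'-↑ˡ-↑ʳ : ∀ p q → UMat' F s T (p ↑ˡ nr) (nl ↑ʳ q) ≡ a
    UMat'-↑ˡ-↑ʳ p q rewrite Finₚ.splitAt-↑ˡ nl p nr | Finₚ.splitAt-↑ʳ nl nr q = refl

    UMat'-↑ʳ-↑ʳ : ∀ p q → UMat' F s T (nl ↑ʳ p) (nl ↑ʳ q) ≡ UMat' F s r p q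
    UMat'-↑ʳ-↑ʳ p q rewrite Finₚ.splitAt-↑ʳ nl nr p | Finₚ.splitAt-↑ʳ nl nr q = refl

  module _ (a b : Carrier) (l r : LTree F) where
    private
      nl = size F l
      nr = size F r

    UMat'-↑ʳ-↑ˡ : ∀ {s} p q → UMat' F s (node a b l r) (nl ↑ʳ p) (q ↑ˡ nr) ≡ lowerLeft s b r p
    UMat'-↑ʳ-↑ˡ {true}  p q rewrite Finₚ.splitAt-↑ʳ nl nr p | Finₚ.splitAt-↑ˡ nl q nr = refl
    UMat'-↑ʳ-↑ˡ {false} p q rewrite Finₚ.splitAt-↑ʳ nl nr p | Finₚ.splitAt-↑ˡ nl q nr = refl

    βmeetN-↑ˡ : ∀ p → βmeetN F (node a b l r) (p ↑ˡ nr) ≡ b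
    βmeetN-↑ˡ p rewrite Finₚ.splitAt-↑ˡ nl p nr = refl

    βmeetN-↑ʳ : ∀ p → βmeetN F (node a b l r) (nl ↑ʳ p) ≡ βmeetN F r p
    βmeetN-↑ʳ p rewrite Finₚ.splitAt-↑ʳ nl nr p = refl

  module NodeColumns (s : Bool) (a b : Carrier) (l r : LTree F) (g : Carrier → Carrier)
                     (y : Fin (size F l ℕ.+ size F r) → Carrier) where
    private
      T = node a b l r
      nl = size F l
      nr = size F r

    yl : Fin nl → Carrier
    yl = y ∘ (_↑ˡ nr)

    yr : Fin nr → Carrier
    yr = y ∘ (nl ↑ʳ_)

    column-↑ˡ : ∀ j → ∑ (λ p → y p * g (UMat' F s T p (j ↑ˡ nr)))
                    ≡ ∑ (λ p → yl p * g (UMat' F false l p j)) + ∑ (λ q → yr q * g (lowerLeft s b r q))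
    column-↑ˡ j = trans (∑-split nl _) (cong₂ _+_
      (∑-cong λ p → cong (λ x → yl p * g x) (UMat'-↑ˡ-↑ˡ a b l r p j))
      (∑-cong λ q → cong (λ x → yr q * g x) (UMat'-↑ʳ-↑ˡ a b l r q j)))

    column-↑ʳ : ∀ j → ∑ (λ p → y p * g (UMat' F s T p (nl ↑ʳ j)))
                    ≡ g a * ∑ yl + ∑ (λ q → yr q * g (UMat' F s r q j))
    column-↑ʳ j = trans (∑-split nl _) (cong₂ _+_
      (∑-*-const yl _ λ p → cong g (UMat'-↑ˡ-↑ʳ a b l r p j))
      (∑-cong λ q → cong (λ x → yr q * g x) (UMat'-↑ʳ-↑ʳ a b l r q j)))

  lastLeaf : (T : LTree F) → Fin (size F T)
  lastLeaf (leaf _)       = zero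
  lastLeaf (node _ _ l r) = size F l ↑ʳ lastLeaf r

  lastValue : LTree F → Carrier
  lastValue (leaf c)       = c
  lastValue (node _ _ _ r) = lastValue r

  suc-toℕ-lastLeaf : ∀ T → suc (toℕ (lastLeaf T)) ≡ size F T
  suc-toℕ-lastLeaf (leaf _)       = refl
  suc-toℕ-lastLeaf (node _ _ l r) = begin
    suc (toℕ (size F l ↑ʳ lastLeaf r))  ≡⟨ cong suc (Finₚ.toℕ-↑ʳ (size F l) (lastLeaf r)) ⟩
    suc (size F l ℕ.+ toℕ (lastLeaf r)) ≡⟨ ℕₚ.+-suc (size F l) _ ⟨
    size F l ℕ.+ suc (toℕ (lastLeaf r)) ≡⟨ cong (size F l ℕ.+_) (suc-toℕ-lastLeaf r) ⟩
    size F l ℕ.+ size F r               ∎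
    where open ≡-Reasoning

  βroot≤diag : ∀ T → Monotone F T → ∀ i → βroot F T ≤ UMat' F false T i i
  βroot≤diag (leaf c)       _ i = ≤-refl
  βroot≤diag (node a b l r) (_ , _ , b≤l , b≤r , ml , mr) =
    ↑-cases (λ i → b ≤ UMat' F false (node a b l r) i i)
      (λ p → subst (b ≤_) (sym (UMat'-↑ˡ-↑ˡ a b l r p p)) (≤-trans b≤l (βroot≤diag l ml p)))
      (λ q → subst (b ≤_) (sym (UMat'-↑ʳ-↑ʳ a b l r q q)) (≤-trans b≤r (βroot≤diag r mr q)))

  βroot≤lastValue : ∀ T → Monotone F T → βroot F T ≤ lastValue T
  βroot≤lastValue (leaf c)       _                          = ≤-refl
  βroot≤lastValue (node a b l r) (_ , _ , _ , b≤r , _ , mr) = ≤-trans b≤r (βroot≤lastValue r mr)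

  βmeetN-bounds : ∀ T → Nonneg F T → Monotone F T → ∀ p → 0# ≤ βmeetN F T p × βmeetN F T p ≤ lastValue T
  βmeetN-bounds (leaf c) 0≤c _ p = 0≤c , ≤-refl
  βmeetN-bounds (node a b l r) (_ , 0≤b , _ , nr) (_ , _ , _ , b≤r , _ , mr) =
    ↑-cases (λ p → 0# ≤ βmeetN F (node a b l r) p × βmeetN F (node a b l r) p ≤ lastValue r)
      (λ p → subst (λ x → 0# ≤ x × x ≤ lastValue r) (sym (βmeetN-↑ˡ a b l r p))
                   (0≤b , ≤-trans b≤r (βroot≤lastValue r mr)))
      (λ q → subst (λ x → 0# ≤ x × x ≤ lastValue r) (sym (βmeetN-↑ʳ a b l r q)) (βmeetN-bounds r nr mr q))

  βmeetN-lastLeaf : ∀ T → βmeetN F T (lastLeaf T) ≡ lastValue T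
  βmeetN-lastLeaf (leaf c)       = refl
  βmeetN-lastLeaf (node a b l r) = trans (βmeetN-↑ʳ a b l r (lastLeaf r)) (βmeetN-lastLeaf r)

  UMat-lastColumn : ∀ T → SpineEq F T → ∀ p → UMat F T p (lastLeaf T) ≡ βmeetN F T p
  UMat-lastColumn (leaf c)       _          p = refl
  UMat-lastColumn (node a b l r) (a≡b , se) = ↑-cases (λ p → UMat F T p (lastLeaf T) ≡ βmeetN F T p)
    (λ p → trans (UMat'-↑ˡ-↑ʳ a b l r p (lastLeaf r)) (trans a≡b (sym (βmeetN-↑ˡ a b l r p))))
    (λ q → trans (UMat'-↑ʳ-↑ʳ a b l r q (lastLeaf r))
                 (trans (UMat-lastColumn r se q) (sym (βmeetN-↑ʳ a b l r q))))
    where T = node a b l r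

  -- Subtrees off the spine

  Dichotomy : (β Y γ : Carrier) → Set → Set
  Dichotomy β Y γ G = (0# ≤ Y × β * Y ≤ γ × G) ⊎ (γ ≤ β * Y × β * Y ≤ 0#)

  dichotomy-of-≡ : ∀ {β Y γ} {G : Set} → 0# ≤ β → γ ≡ β * Y → (0# ≤ Y → G) → Dichotomy β Y γ G
  dichotomy-of-≡ {Y = Y} 0≤β γ≡βY G-of-0≤Y with total 0# Y
  ... | inj₁ 0≤Y = inj₁ (0≤Y , ≤-reflexive (sym γ≡βY) , G-of-0≤Y 0≤Y)
  ... | inj₂ Y≤0 = inj₂ (≤-reflexive γ≡βY , *-nonpos 0≤β Y≤0)

  -- The inequalities behind one node (a, b) off the spine, for A = a − d and B = b − d. As the
  -- block of U above the diagonal is a and the one below is b, the left subtree sees the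
  -- column sums u and the right subtree w.
  module NodeBounds {A B βl βr : Carrier} (0≤A : 0# ≤ A) (A≤B : A ≤ B) (B≤βl : B ≤ βl) (B≤βr : B ≤ βr)
                    (Yl Yr γ : Carrier) where
    open ≤-Reasoning

    0≤B : 0# ≤ B
    0≤B = ≤-trans 0≤A A≤B

    u w : Carrier
    u = γ − B * Yr
    w = γ − A * Yl

    left-degenerate⇒γ≤BY : u ≤ βl * Yl → βl * Yl ≤ 0# → γ ≤ B * (Yl + Yr)
    left-degenerate⇒γ≤BY u≤βlYl βlYl≤0 = begin
      γ                 ≡⟨ x−y+y≡x γ (B * Yr) ⟨
      u + B * Yr        ≤⟨ +-monoˡ _ u≤βlYl ⟩
      βl * Yl + B * Yr  ≤⟨ +-monoˡ _ (proj₁ (scale-down-nonpos 0≤B B≤βl βlYl≤0)) ⟩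
      B * Yl + B * Yr   ≡⟨ distribˡ B Yl Yr ⟨
      B * (Yl + Yr)     ∎

    right-degenerate⇒γ≤BY : 0# ≤ Yl → w ≤ βr * Yr → βr * Yr ≤ 0# → γ ≤ B * (Yl + Yr)
    right-degenerate⇒γ≤BY 0≤Yl w≤βrYr βrYr≤0 = begin
      γ                 ≡⟨ x−y+y≡x γ (A * Yl) ⟨
      w + A * Yl        ≤⟨ +-mono-≤ (≤-trans w≤βrYr (proj₁ (scale-down-nonpos 0≤B B≤βr βrYr≤0)))
                                    (*-monoʳ-≤-nonneg 0≤Yl A≤B) ⟩
      B * Yr + B * Yl   ≡⟨ +-comm _ _ ⟩
      B * Yl + B * Yr   ≡⟨ distribˡ B Yl Yr ⟨
      B * (Yl + Yr)     ∎

    left-regular⇒BY≤γ : 0# ≤ Yl → βl * Yl ≤ u → B * (Yl + Yr) ≤ γ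
    left-regular⇒BY≤γ 0≤Yl βlYl≤u = begin
      B * (Yl + Yr)     ≡⟨ distribˡ B Yl Yr ⟩
      B * Yl + B * Yr   ≤⟨ +-monoˡ _ (≤-trans (*-monoʳ-≤-nonneg 0≤Yl B≤βl) βlYl≤u) ⟩
      u + B * Yr        ≡⟨ x−y+y≡x γ (B * Yr) ⟩
      γ                 ∎

    right-regular⇒BY≤γ : βl * Yl ≤ 0# → 0# ≤ Yr → βr * Yr ≤ w → B * (Yl + Yr) ≤ γ
    right-regular⇒BY≤γ βlYl≤0 0≤Yr βrYr≤w = begin
      B * (Yl + Yr)     ≡⟨ distribˡ B Yl Yr ⟩
      B * Yl + B * Yr   ≤⟨ +-mono-≤ (proj₁ (scale-down-nonpos 0≤A A≤B BYl≤0))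
                                    (≤-trans (*-monoʳ-≤-nonneg 0≤Yr B≤βr) βrYr≤w) ⟩
      A * Yl + w        ≡⟨ x+[y−x]≡y (A * Yl) γ ⟩
      γ                 ∎
      where BYl≤0 = proj₂ (scale-down-nonpos 0≤B B≤βl βlYl≤0)

    degenerate⇒BY≤0 : βl * Yl ≤ 0# → βr * Yr ≤ 0# → B * (Yl + Yr) ≤ 0#
    degenerate⇒BY≤0 βlYl≤0 βrYr≤0 = begin
      B * (Yl + Yr)     ≡⟨ distribˡ B Yl Yr ⟩
      B * Yl + B * Yr   ≤⟨ +-mono-≤ (proj₂ (scale-down-nonpos 0≤B B≤βl βlYl≤0))
                                    (proj₂ (scale-down-nonpos 0≤B B≤βr βrYr≤0)) ⟩
      0# + 0#           ≡⟨ +-identityʳ 0# ⟩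
      0#                ∎

    regular⇒γ≤μY-left : ∀ {μ} → 0# ≤ Yr → B ≤ μ → u ≤ μ * Yl → γ ≤ μ * (Yl + Yr)
    regular⇒γ≤μY-left {μ} 0≤Yr B≤μ u≤μYl = begin
      γ                 ≡⟨ x−y+y≡x γ (B * Yr) ⟨
      u + B * Yr        ≤⟨ +-mono-≤ u≤μYl (*-monoʳ-≤-nonneg 0≤Yr B≤μ) ⟩
      μ * Yl + μ * Yr   ≡⟨ distribˡ μ Yl Yr ⟨
      μ * (Yl + Yr)     ∎

    regular⇒γ≤μY-right : ∀ {μ} → 0# ≤ Yl → A ≤ μ → w ≤ μ * Yr → γ ≤ μ * (Yl + Yr)
    regular⇒γ≤μY-right {μ} 0≤Yl A≤μ w≤μYr = begin
      γ                 ≡⟨ x−y+y≡x γ (A * Yl) ⟨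
      w + A * Yl        ≤⟨ +-mono-≤ w≤μYr (*-monoʳ-≤-nonneg 0≤Yl A≤μ) ⟩
      μ * Yr + μ * Yl   ≡⟨ +-comm _ _ ⟩
      μ * Yl + μ * Yr   ≡⟨ distribˡ μ Yl Yr ⟨
      μ * (Yl + Yr)     ∎

  -- The second alternative is unavoidable: the shifted blocks U_T − d need not be invertible.
  OffSpineBounds : (T : LTree F) → Carrier → (Fin (size F T) → Carrier) → Carrier → Set
  OffSpineBounds T d y γ = Dichotomy (βroot F T − d) (∑ y) γ (∀ i → γ ≤ (UMat' F false T i i − d) * ∑ y)

  offSpine-bounds : ∀ T {d} → d ≤ αroot F T → AlphaLeBeta F T → Monotone F T →
                    ∀ y γ → (∀ j → (y ᵀ· (UMat' F false T −ᴹ d)) j ≡ γ) → OffSpineBounds T d y γ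
  offSpine-bounds (leaf c) {d} d≤c _ _ y γ cols =
    dichotomy-of-≡ (x≤y⇒0≤y−x d≤c) γ≡[c−d]Y (λ _ _ → ≤-reflexive γ≡[c−d]Y)
    where
    γ≡[c−d]Y : γ ≡ (c − d) * ∑ y
    γ≡[c−d]Y = trans (sym (cols zero))
      (solve 3 (λ y c d → y :* (c :- d) :+ con (ℤ.+ 0) := (c :- d) :* (y :+ con (ℤ.+ 0))) refl (y zero) c d)
  offSpine-bounds (node a b l r) {d} d≤a (a≤b , αβl , αβr) mono@(a≤αl , a≤αr , b≤βl , b≤βr , ml , mr)
                  y γ cols =
    subst (λ Y → Dichotomy (b − d) Y γ (∀ i → γ ≤ (UMat' F false T i i − d) * Y)) (sym (∑-split nl y))
          (combine (offSpine-bounds l (≤-trans d≤a a≤αl) αβl ml yl u cols-l)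
                   (offSpine-bounds r (≤-trans d≤a a≤αr) αβr mr yr w cols-r))
    where
    T = node a b l r
    nl = size F l
    nr = size F r
    open NodeColumns false a b l r (_− d) y
    open NodeBounds (x≤y⇒0≤y−x d≤a) (+-monoˡ (- d) a≤b) (+-monoˡ (- d) b≤βl) (+-monoˡ (- d) b≤βr)
                    (∑ yl) (∑ yr) γ

    cols-l : ∀ j → (yl ᵀ· (UMat' F false l −ᴹ d)) j ≡ u
    cols-l j = x+z≡y⇒x≡y−z (trans (cong ((yl ᵀ· (UMat' F false l −ᴹ d)) j +_)
                                        (trans (*-comm _ _) (sym (∑-*ʳ yr _))))
                                  (trans (sym (column-↑ˡ j)) (cols (j ↑ˡ nr))))

    cols-r : ∀ j → (yr ᵀ· (UMat' F false r −ᴹ d)) j ≡ w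
    cols-r j = x+z≡y⇒x≡y−z (trans (+-comm _ _) (trans (sym (column-↑ʳ j)) (cols (nl ↑ʳ j))))

    Y = ∑ yl + ∑ yr
    Diag : Carrier → Set
    Diag Z = ∀ i → γ ≤ (UMat' F false T i i − d) * Z

    B≤diag : ∀ i → b − d ≤ UMat' F false T i i − d
    B≤diag i = +-monoˡ (- d) (βroot≤diag T mono i)

    collapse : γ ≤ (b − d) * Y → (b − d) * Y ≤ γ → Dichotomy (b − d) Y γ (Diag Y)
    collapse γ≤BY BY≤γ = dichotomy-of-≡ 0≤B γ≡BY
      (λ 0≤Y i → ≤-trans (≤-reflexive γ≡BY) (*-monoʳ-≤-nonneg 0≤Y (B≤diag i)))
      where γ≡BY = ≤-antisym γ≤BY BY≤γ

    regularDiag : 0# ≤ ∑ yl → 0# ≤ ∑ yr →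
      (∀ p → u ≤ (UMat' F false l p p − d) * ∑ yl) →
      (∀ q → w ≤ (UMat' F false r q q − d) * ∑ yr) → Diag Y
    regularDiag 0≤Yl 0≤Yr Gl Gr = ↑-cases (λ i → γ ≤ (UMat' F false T i i − d) * Y)
      (λ p → subst (λ x → γ ≤ (x − d) * Y) (sym (UMat'-↑ˡ-↑ˡ a b l r p p))
         (regular⇒γ≤μY-left 0≤Yr (+-monoˡ (- d) (≤-trans b≤βl (βroot≤diag l ml p))) (Gl p)))
      (λ q → subst (λ x → γ ≤ (x − d) * Y) (sym (UMat'-↑ʳ-↑ʳ a b l r q q))
         (regular⇒γ≤μY-right 0≤Yl (+-monoˡ (- d) (≤-trans a≤b (≤-trans b≤βr (βroot≤diag r mr q))))
                             (Gr q)))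

    combine : OffSpineBounds l d yl u → OffSpineBounds r d yr w → Dichotomy (b − d) Y γ (Diag Y)
    combine (inj₁ (0≤Yl , βlYl≤u , Gl)) (inj₁ (0≤Yr , βrYr≤w , Gr)) =
      inj₁ (+-nonneg 0≤Yl 0≤Yr , left-regular⇒BY≤γ 0≤Yl βlYl≤u , regularDiag 0≤Yl 0≤Yr Gl Gr)
    combine (inj₁ (0≤Yl , βlYl≤u , _)) (inj₂ (w≤βrYr , βrYr≤0)) =
      collapse (right-degenerate⇒γ≤BY 0≤Yl w≤βrYr βrYr≤0) (left-regular⇒BY≤γ 0≤Yl βlYl≤u)
    combine (inj₂ (u≤βlYl , βlYl≤0)) (inj₁ (0≤Yr , βrYr≤w , _)) =
      collapse (left-degenerate⇒γ≤BY u≤βlYl βlYl≤0) (right-regular⇒BY≤γ βlYl≤0 0≤Yr βrYr≤w)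
    combine (inj₂ (u≤βlYl , βlYl≤0)) (inj₂ (_ , βrYr≤0)) =
      inj₂ (left-degenerate⇒γ≤BY u≤βlYl βlYl≤0 , degenerate⇒BY≤0 βlYl≤0 βrYr≤0)

  offSpine-sum-nonpos : ∀ T {a} → a ≤ αroot F T → AlphaLeBeta F T → Monotone F T →
                        ∀ y → (∀ j → (y ᵀ· (UMat' F false T −ᴹ a)) j ≡ - 1#) →
                        ∑ y ≤ 0# × (∀ i → 1# ≤ (UMat' F false T i i − a) * - ∑ y)
  offSpine-sum-nonpos T {a} a≤α αβ mono y cols with offSpine-bounds T a≤α αβ mono (λ p → - y p) 1# cols-neg
    where
    cols-neg : ∀ j → ((λ p → - y p) ᵀ· (UMat' F false T −ᴹ a)) j ≡ 1#
    cols-neg j = trans (ᵀ·-neg y (UMat' F false T −ᴹ a) j)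
                       (trans (cong -_ (cols j)) (solve 1 (λ x → :- :- x := x) refl 1#))
  ... | inj₁ (0≤-∑y , _ , diag) = 0≤-x⇒x≤0 (subst (0# ≤_) (∑-neg y) 0≤-∑y) ,
                                  λ i → subst (λ Z → 1# ≤ _ * Z) (∑-neg y) (diag i)
  ... | inj₂ (1≤βZ , βZ≤0)     = ⊥-elim (1≰0 (≤-trans 1≤βZ βZ≤0))

  -- The spine

  SpineBounds : (T : LTree F) → (Fin (size F T) → Carrier) → Carrier → Set
  SpineBounds T y θ = lastValue T * ∑ y ≤ 1# − θ
    × (∀ i → ¬ (i ≡ lastLeaf T) → UMat F T i i ≤ lastValue T → lastValue T * ∑ y ≤ - θ)

  -- θ carries the contributions a * ∑ yl of the spine nodes above T to the columns below them.
  spine-bounds : ∀ T → AlphaLeBeta F T → Monotone F T → SpineEq F T →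
                 ∀ y θ → (∀ j → θ + (y ᵀ· UMat F T) j ≡ idM F (lastLeaf T) j) → SpineBounds T y θ
  spine-bounds (leaf c) _ _ _ y θ cols = ≤-reflexive cY≡1−θ , λ { zero 0≢0 _ → ⊥-elim (0≢0 refl) }
    where
    cY≡1−θ : c * ∑ y ≡ 1# − θ
    cY≡1−θ = trans (solve 3 (λ c y θ → c :* (y :+ con (ℤ.+ 0)) := θ :+ (y :* c :+ con (ℤ.+ 0)) :- θ)
                            refl c (y zero) θ)
                   (cong (_− θ) (cols zero))
  spine-bounds (node a b l r) (a≤b , αβl , αβr) (a≤αl , _ , _ , b≤βr , ml , mr) (a≡b , spr) y θ cols =
    bound , ↑-cases (λ i → ¬ (i ≡ lastLeaf T) → UMat F T i i ≤ c → c * ∑ y ≤ - θ)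
                    (λ p _ → left-bound p ∘ subst (_≤ c) (UMat'-↑ˡ-↑ˡ a b l r p p))
                    right-bound
    where
    T = node a b l r
    nl = size F l
    nr = size F r
    c = lastValue r
    open NodeColumns true a b l r (λ x → x) y
    Yl = ∑ yl
    θ′ = θ + a * Yl
    Φ = ∑ (λ q → yr q * βmeetN F r q)

    cols-r : ∀ j → θ′ + (yr ᵀ· UMat F r) j ≡ idM F (lastLeaf r) j
    cols-r j = trans (+-assoc θ _ _)
      (trans (cong (θ +_) (sym (column-↑ʳ j))) (trans (cols (nl ↑ʳ j)) (idM-↑ʳ nl _ j)))

    r-bounds : SpineBounds r yr θ′
    r-bounds = spine-bounds r αβr mr spr yr θ′ cols-r

    θ′+Φ≡1 : θ′ + Φ ≡ 1#
    θ′+Φ≡1 = trans (cong (θ′ +_) (∑-cong λ q → cong (yr q *_) (sym (UMat-lastColumn r spr q))))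
                   (trans (cols-r (lastLeaf r)) (idM-diag (lastLeaf r)))

    column-l : ∀ j → θ + ((yl ᵀ· UMat' F false l) j + Φ) ≡ 0#
    column-l j = trans (cong (θ +_) (sym (column-↑ˡ j)))
                       (trans (cols (j ↑ˡ nr)) (idM-↑ʳ-↑ˡ (lastLeaf r) j))

    cols-l : ∀ j → (yl ᵀ· (UMat' F false l −ᴹ a)) j ≡ - 1#
    cols-l j = begin
      (yl ᵀ· (UMat' F false l −ᴹ a)) j  ≡⟨ ∑-*-shift yl _ a ⟩
      X − Yl * a                        ≡⟨ solve 5 (λ θ a Yl Φ X → X :- Yl :* a
                                                                 := (θ :+ (X :+ Φ)) :- (θ :+ a :* Yl :+ Φ))
                                                   refl θ a Yl Φ X ⟩
      (θ + (X + Φ)) − (θ′ + Φ)          ≡⟨ cong₂ _−_ (column-l j) θ′+Φ≡1 ⟩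
      0# − 1#                           ≡⟨ +-identityˡ _ ⟩
      - 1#                              ∎
      where
      open ≡-Reasoning
      X = (yl ᵀ· UMat' F false l) j

    left-facts : Yl ≤ 0# × (∀ p → 1# ≤ (UMat' F false l p p − a) * - Yl)
    left-facts = offSpine-sum-nonpos l a≤αl αβl ml yl cols-l

    a≤c : a ≤ c
    a≤c = ≤-trans a≤b (≤-trans b≤βr (βroot≤lastValue r mr))

    absorb : ∀ {t} → c * ∑ yr ≤ t − a * Yl → c * ∑ y ≤ t
    absorb {t} cYr≤t−aYl = begin
      c * ∑ y                ≡⟨ cong (c *_) (∑-split nl y) ⟩
      c * (Yl + ∑ yr)        ≡⟨ distribˡ c Yl _ ⟩
      c * Yl + c * ∑ yr      ≤⟨ +-mono-≤ (*-antimonoʳ-≤-nonpos (proj₁ left-facts) a≤c) cYr≤t−aYl ⟩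
      a * Yl + (t − a * Yl)  ≡⟨ x+[y−x]≡y (a * Yl) t ⟩
      t                      ∎
      where open ≤-Reasoning

    bound : c * ∑ y ≤ 1# − θ
    bound = absorb (subst (c * ∑ yr ≤_) (solve 4 (λ θ a Yl one → one :- (θ :+ a :* Yl) := one :- θ :- a :* Yl)
                                                 refl θ a Yl 1#)
                          (proj₁ r-bounds))

    right-bound : ∀ q → ¬ (nl ↑ʳ q ≡ lastLeaf T) → UMat F T (nl ↑ʳ q) (nl ↑ʳ q) ≤ c → c * ∑ y ≤ - θ
    right-bound q q≢last m≤c = absorb
      (subst (c * ∑ yr ≤_) (solve 3 (λ θ a Yl → :- (θ :+ a :* Yl) := :- θ :- a :* Yl) refl θ a Yl)
             (proj₂ r-bounds q (q≢last ∘ cong (nl ↑ʳ_)) (subst (_≤ c) (UMat'-↑ʳ-↑ʳ a b l r q q) m≤c)))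

    left-bound : ∀ p → UMat' F false l p p ≤ c → c * ∑ y ≤ - θ
    left-bound p m≤c = subst (λ Y → c * Y ≤ - θ) (sym (∑-split nl y)) (≤-from-difference
      (solve 7 (λ one θ a c m Yl Yr → :- θ :- c :* (Yl :+ Yr)
                  := (one :- (θ :+ a :* Yl) :- c :* Yr) :+ (c :- m) :* :- Yl :+ ((m :- a) :* :- Yl :- one))
               refl 1# θ a c m Yl (∑ yr))
      (+-nonneg (+-nonneg (x≤y⇒0≤y−x (proj₁ r-bounds))
                          (*-nonneg (x≤y⇒0≤y−x m≤c) (x≤0⇒0≤-x (proj₁ left-facts))))
                (x≤y⇒0≤y−x (proj₂ left-facts p))))
      where m = UMat' F false l p p

  lastRow-sum-nonpos : ∀ T → ValidU F T →
                       ∀ y → (∀ j → (y ᵀ· UMat F T) j ≡ idM F (lastLeaf T) j) →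
                       ∀ i → ¬ (i ≡ lastLeaf T) → UMat F T i i ≤ UMat F T (lastLeaf T) (lastLeaf T) →
                       ∑ y ≤ 0#
  lastRow-sum-nonpos T (nonneg , _ , αβ , mono , spine) y cols i i≢n Uii≤Unn =
    *-cancelˡ-nonpos 0≤c c≢0 (subst (c * ∑ y ≤_) -0#≡0#
      (proj₂ (spine-bounds T αβ mono spine y 0# (λ j → trans (+-identityˡ _) (cols j)))
             i i≢n (subst (UMat F T i i ≤_) Unn≡c Uii≤Unn)))
    where
    n = lastLeaf T
    c = lastValue T

    Unn≡c : UMat F T n n ≡ c
    Unn≡c = trans (UMat-lastColumn T spine n) (βmeetN-lastLeaf T)

    0≤c : 0# ≤ c
    0≤c = subst (0# ≤_) (βmeetN-lastLeaf T) (proj₁ (βmeetN-bounds T nonneg mono n))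

    c≢0 : ¬ (c ≡ 0#)
    c≢0 c≡0 = 0≢1 (begin
      0#                  ≡⟨ zeroˡ (∑ y) ⟨
      0# * ∑ y            ≡⟨ ∑-*-const y _ lastColumn≡0 ⟨
      (y ᵀ· UMat F T) n   ≡⟨ cols n ⟩
      idM F n n           ≡⟨ idM-diag n ⟩
      1#                  ∎)
      where
      open ≡-Reasoning
      lastColumn≡0 : ∀ p → UMat F T p n ≡ 0#
      lastColumn≡0 p = trans (UMat-lastColumn T spine p)
        (≤-antisym (subst (βmeetN F T p ≤_) c≡0 (proj₂ (βmeetN-bounds T nonneg mono p)))
                   (proj₁ (βmeetN-bounds T nonneg mono p)))

  cast-fromℕ : ∀ T {k} (e : size F T ≡ suc k) → cast (sym e) (fromℕ k) ≡ lastLeaf T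
  cast-fromℕ T {k} e = Finₚ.toℕ-injective (begin
    toℕ (cast (sym e) (fromℕ k))  ≡⟨ Finₚ.toℕ-cast (sym e) (fromℕ k) ⟩
    toℕ (fromℕ k)                 ≡⟨ Finₚ.toℕ-fromℕ k ⟩
    k                             ≡⟨ ℕₚ.suc-injective (trans (suc-toℕ-lastLeaf T) e) ⟨
    toℕ (lastLeaf T)              ∎)
    where open ≡-Reasoning

  module _ {k} (T : LTree F) (e : size F T ≡ suc k) where
    private
      n = fromℕ k
      last = lastLeaf T

    cast-lastLeaf : cast e last ≡ n
    cast-lastLeaf = trans (cong (cast e) (sym (cast-fromℕ T e))) (Finₚ.cast-involutive e (sym e) n)

    lastRow-columns : {U V : Matrix F (suc k)} →
                      (∀ i j → U i j ≡ UMat F T (cast (sym e) i) (cast (sym e) j)) →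
                      (∀ i j → _·_ F V U i j ≡ idM F i j) →
                      ∀ j → ((V n ∘ cast e) ᵀ· UMat F T) j ≡ idM F last j
    lastRow-columns {U} {V} U≡UMat VU≡I j = begin
      ∑ (λ p → V n (cast e p) * UMat F T p j)
        ≡⟨ ∑-cong (λ p → cong (V n (cast e p) *_)
                             (sym (trans (U≡UMat _ _) (cong₂ (UMat F T) (back p) (back j))))) ⟩
      ∑ (λ p → V n (cast e p) * U (cast e p) (cast e j))
        ≡⟨ ∑-cast e (λ q → V n q * U q (cast e j)) ⟩
      _·_ F V U n (cast e j)
        ≡⟨ VU≡I n (cast e j) ⟩
      idM F n (cast e j)
        ≡⟨ cong (λ x → idM F x (cast e j)) cast-lastLeaf ⟨
      idM F (cast e last) (cast e j)
        ≡⟨ idM-cast e last j ⟩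
      idM F last j ∎
      where
      open ≡-Reasoning
      back : ∀ p → cast (sym e) (cast e p) ≡ p
      back = Finₚ.cast-involutive (sym e) e

    cast-≢-lastLeaf : ∀ {i} → ¬ (i ≡ n) → ¬ (cast (sym e) i ≡ last)
    cast-≢-lastLeaf {i} i≢n i′≡last =
      i≢n (trans (sym (Finₚ.cast-involutive e (sym e) i)) (trans (cong (cast e) i′≡last) cast-lastLeaf))

corollary3p6 : (F : OrderedField) → (k : ℕ) → (U V : Matrix F (suc k)) →
    IsUMatrix F U → IsInverse F U V →
    Σ (Fin (suc k)) (λ i → ¬ (i ≡ fromℕ k) × OrderedField._≤_ F (U i i) (U (fromℕ k) (fromℕ k))) →
    OrderedField._≤_ F (rowSum F V (fromℕ k)) (OrderedField.0# F)
corollary3p6 F k U V (T , e , valid , U≡UMat) (_ , VU≡I) (i , i≢n , Uii≤Unn) =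
  subst (_≤ 0#) (∑-cast F e (V n))
    (lastRow-sum-nonpos F T valid (V n ∘ cast e) (lastRow-columns F T e {V = V} U≡UMat VU≡I)
      (cast (sym e) i) (cast-≢-lastLeaf F T e i≢n)
      (subst₂ _≤_ (U≡UMat i i) (trans (U≡UMat n n) (cong₂ (UMat F T) cast-n cast-n)) Uii≤Unn))
  where
  open OrderedField F using (_≤_; 0#)
  n = fromℕ k
  cast-n = cast-fromℕ F T e
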